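{- For every nonnegative integer $n$, let $LG_1(n)$ be the number of partitions of $n$ in which any two consecutive parts differ by at least $2$, and by at least $4$ if both are odd. Let $E(n)$ be the number of signed partitions of $n$ with $k$ positive parts, which are even and distinct, and $t$ negative parts, which are odd, distinct and each less than $2k$, such that the smallest positive part is greater than $2t-\delta_{1u}$, where $u$ is the smallest negative part (and $\delta_{1u}=1$ if $u=1$, $\delta_{1u}=0$ otherwise, including when there are no negative parts). Then $LG_1(n)=E(n)$ for all $n\ge 0$.
   Context: A partition of an integer $n$ is a finite nonincreasing sequence of positive integers (its parts) summing to $n$. A signed partition of an integer $n$ is a pair $(\pi,\nu)$ of ordinary partitions with $|\pi|-|\nu|=n$, where $|\cdot|$ denotes the sum of parts; the parts of $\pi$ are the positive parts and the parts of $\nu$ are the negative parts (their sizes). $\delta$ is the Kronecker delta. -}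

module Defs where

open import Data.Nat using (ℕ; zero; suc; _+_; _*_; _∸_; _≤_; _<_; _≥_; _>_; _%_)
open import Data.Nat.ListAction using (sum)
open import Data.List using (List; []; _∷_; length; last)
open import Data.List.Relation.Unary.All using (All)
open import Data.List.Relation.Unary.Linked using (Linked)
open import Data.Maybe using (Maybe; just; nothing)
open import Data.Bool using (Bool; true; false; if_then_else_; _∧_)
open import Data.Unit using (⊤)
open import Data.Product using (Σ; _×_)
open import Relation.Binary.PropositionalEquality using (_≡_)

IsPartition : List ℕ → Set
IsPartition l = All (0 <_) l × Linked _≥_ l

Even Odd : ℕ → Set
Even p = p % 2 ≡ 0
Odd  p = p % 2 ≡ 1

isOdd : ℕ → Bool
isOdd p with p % 2
... | 0 = false
... | _ = true

LGgap : ℕ → ℕ → ℕ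
LGgap a b = if isOdd a ∧ isOdd b then 4 else 2

LGRel : ℕ → ℕ → Set
LGRel a b = b + LGgap a b ≤ a

LG₁Set : ℕ → Set
LG₁Set n = Σ (List ℕ) λ λs →
  IsPartition λs × sum λs ≡ n × Linked LGRel λs

-- For a nonincreasing list, the parts are distinct iff consecutive parts
-- are strictly decreasing.
Distinct : List ℕ → Set
Distinct l = Linked _>_ l

-- Kronecker delta δ_{1u} where u is the smallest negative part
-- (0 when there are no negative parts).
δ₁ : List ℕ → ℕ
δ₁ ν with last ν
... | just 1 = 1
... | _      = 0

SmallestCond : List ℕ → List ℕ → Set
SmallestCond π ν with last π
... | nothing = ⊤
... | just s  = 2 * length ν ∸ δ₁ ν < s

ESet : ℕ → Set
ESet n = Σ (List ℕ) λ π → Σ (List ℕ) λ ν →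
  IsPartition π × IsPartition ν ×
  sum π ≡ n + sum ν ×
  All Even π × Distinct π ×
  All Odd ν × Distinct ν × All (_< 2 * length π) ν ×
  SmallestCond π ν

{-# OPTIONS --safe #-}

-- Write an LG partition as λ₁ > ⋯ > λₖ and let cᵢ be the number of odd parts larger than λᵢ.
-- The bijection sends λᵢ to the even positive part λᵢ + [λᵢ odd] + 2cᵢ and every odd λᵢ to
-- the negative part 2(k − i) + 1.  For two consecutive parts, the LG gap condition is
-- equivalent to the strict decrease of the corresponding even parts, and, since c + t is
-- invariant along the list (t the number of odd parts still to come), the condition on the
-- smallest positive part says exactly that λₖ > 0.  Conversely λ is read off (π, ν) from the
-- top: λᵢ is odd iff 2(k − i) + 1 is the largest negative part not yet used.  Finiteness
-- holds because an LG partition of n is a strictly decreasing list of numbers in 1..n.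

module Submission where

open import Defs
open import Data.Bool using (true; false; _∧_)
open import Data.Empty using (⊥-elim)
open import Data.Fin using (Fin; zero; suc)
open import Data.List using (List; []; _∷_; length; last; lookup; _++_; map; filter; deduplicate)
import Data.List.Properties as List
open import Data.List.Membership.Propositional using (_∈_)
open import Data.List.Membership.Propositional.Properties
  using (∈-lookup; ∈-filter⁺; ∈-filter⁻; ∈-deduplicate⁺; ∈-deduplicate⁻; ∈-++⁺ˡ; ∈-++⁺ʳ; ∈-map⁺)
open import Data.List.Membership.Propositional.Properties.WithK using (unique⇒irrelevant)
open import Data.List.Relation.Unary.All as All using (All; []; _∷_)
import Data.List.Relation.Unary.All.Properties as All
import Data.List.Relation.Unary.AllPairs as AllPairs
open import Data.List.Relation.Unary.Any as Any using (here; there)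
open import Data.List.Relation.Unary.Linked as Linked using (Linked; []; [-]; _∷_)
open import Data.List.Relation.Unary.Linked.Properties using (Linked⇒All; Linked⇒AllPairs)
open import Data.List.Relation.Unary.Unique.DecPropositional.Properties using (deduplicate-!)
open import Data.Maybe using (Maybe; just; nothing)
open import Data.Maybe.Relation.Unary.All as Maybe using (just; nothing)
open import Data.Nat
  using (ℕ; zero; suc; _+_; _*_; _∸_; _%_; _≤_; _<_; _>_; z≤n; s≤s; z<s; s≤s⁻¹; _≟_; _≤?_; _<?_; >-nonZero)
open import Data.Nat.DivMod using (m*n%n≡0; [m+kn]%n≡m%n)
open import Data.Nat.ListAction using (sum)
open import Data.Nat.Properties
open import Data.Nat.Tactic.RingSolver using (solve-∀)
open import Data.Product using (Σ; ∃; _×_; _,_; proj₁; proj₂)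
open import Data.Sum using (inj₁; inj₂)
open import Data.Unit using (tt)
open import Function.Base using (_∘_; flip)
open import Function.Bundles using (_⇔_; mk⇔; Equivalence; _↔_; mk↔ₛ′)
open import Function.Properties.Equivalence using (⇔-setoid)
open import Function.Properties.Inverse using (↔-trans; ↔-sym)
open import Level using (0ℓ)
open import Relation.Binary.Definitions using (DecidableEquality)
open import Relation.Binary.PropositionalEquality
import Relation.Binary.Reasoning.Setoid as SetoidReasoning
open import Relation.Nullary using (Dec; yes; no; Irrelevant)
open import Relation.Nullary.Decidable using (_×-dec_)
import Relation.Unary as U

module ⇔-Reasoning = SetoidReasoning (⇔-setoid 0ℓ)

infixr 2 _×-irrelevant_
_×-irrelevant_ : ∀ {A B : Set} → Irrelevant A → Irrelevant B → Irrelevant (A × B)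
(irrA ×-irrelevant irrB) (a , b) (a′ , b′) = cong₂ _,_ (irrA a a′) (irrB b b′)

All⇒Linked-∷ : ∀ {A : Set} {R : A → A → Set} {v xs} → All (R v) xs → Linked R xs → Linked R (v ∷ xs)
All⇒Linked-∷ [] [] = [-]
All⇒Linked-∷ (r ∷ _) rs = r ∷ rs

Linked>⇒All< : ∀ {v ν} → Linked _>_ (v ∷ ν) → All (_< v) ν
Linked>⇒All< ds = AllPairs.head (Linked⇒AllPairs (flip <-trans) ds)

last⇒All : ∀ {A : Set} {R : A → A → Set} {P : A → Set} → (∀ {a b} → R a b → P b → P a) →
           ∀ {xs} → Linked R xs → Maybe.All P (last xs) → All P xs
last⇒All up [] _ = []
last⇒All up [-] (just p) = p ∷ []
last⇒All up (r ∷ rs) ps with last⇒All up rs ps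
... | qs@(q ∷ _) = up r q ∷ qs

index-∈-lookup : ∀ {A : Set} (xs : List A) i → Any.index (∈-lookup {xs = xs} i) ≡ i
index-∈-lookup (x ∷ xs) zero = refl
index-∈-lookup (x ∷ xs) (suc i) = cong suc (index-∈-lookup xs i)

∈-lookup-index : ∀ {A : Set} {x : A} {xs} (x∈xs : x ∈ xs) →
                 _≡_ {A = ∃ (_∈ xs)} (lookup xs (Any.index x∈xs) , ∈-lookup (Any.index x∈xs)) (x , x∈xs)
∈-lookup-index (here refl) = refl
∈-lookup-index (there x∈xs) = cong (λ (y , y∈xs) → y , there y∈xs) (∈-lookup-index x∈xs)

∃∈↔Fin-length : ∀ {A : Set} (xs : List A) → ∃ (_∈ xs) ↔ Fin (length xs)
∃∈↔Fin-length xs = mk↔ₛ′ (Any.index ∘ proj₂) (λ i → lookup xs i , ∈-lookup i)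
  (index-∈-lookup xs) (∈-lookup-index ∘ proj₂)

module _ {A : Set} (_≟ᴬ_ : DecidableEquality A)
         {P : A → Set} (P? : U.Decidable P) (P-irrelevant : U.Irrelevant P) where

  covered⇒Σ↔Fin : (xs : List A) → (∀ {x} → P x → x ∈ xs) → ∃ λ m → Σ A P ↔ Fin m
  covered⇒Σ↔Fin xs P⊆xs = length ys , ↔-trans (mk↔ₛ′ to from to∘from from∘to) (∃∈↔Fin-length ys)
    where
    ys = deduplicate _≟ᴬ_ (filter P? xs)
    to : Σ A P → ∃ (_∈ ys)
    to (x , px) = x , ∈-deduplicate⁺ _≟ᴬ_ (∈-filter⁺ P? (P⊆xs px) px)
    from : ∃ (_∈ ys) → Σ A P
    from (x , x∈ys) = x , proj₂ (∈-filter⁻ P? {xs = xs} (∈-deduplicate⁻ _≟ᴬ_ (filter P? xs) x∈ys))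
    to∘from : ∀ y → to (from y) ≡ y
    to∘from (x , _) = cong (x ,_) (unique⇒irrelevant (deduplicate-! _≟ᴬ_ (filter P? xs)) _ _)
    from∘to : ∀ p → from (to p) ≡ p
    from∘to (x , _) = cong (x ,_) (P-irrelevant _ _)

-- Written k * 2 rather than 2 * k so that suc k * 2 reduces to suc (suc (k * 2)).
data Parity : ℕ → Set where
  even : ∀ k → Parity (k * 2)
  odd  : ∀ k → Parity (suc (k * 2))

parity : ∀ n → Parity n
parity zero = even 0
parity (suc zero) = odd 0
parity (suc (suc n)) with parity n
... | even k = even (suc k)
... | odd k = odd (suc k)

parity-k*2 : ∀ k → parity (k * 2) ≡ even k
parity-k*2 zero = refl
parity-k*2 (suc k) rewrite parity-k*2 k = refl

parity-1+k*2 : ∀ k → parity (suc (k * 2)) ≡ odd k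
parity-1+k*2 zero = refl
parity-1+k*2 (suc k) rewrite parity-1+k*2 k = refl

Even-k*2 : ∀ k → Even (k * 2)
Even-k*2 k = m*n%n≡0 k 2

Odd-1+k*2 : ∀ k → Odd (suc (k * 2))
Odd-1+k*2 k = [m+kn]%n≡m%n 1 k 2

isOdd-k*2 : ∀ k → isOdd (k * 2) ≡ false
isOdd-k*2 k rewrite Even-k*2 k = refl

isOdd-1+k*2 : ∀ k → isOdd (suc (k * 2)) ≡ true
isOdd-1+k*2 k rewrite Odd-1+k*2 k = refl

k*2≢1+j*2 : ∀ k j → k * 2 ≢ suc (j * 2)
k*2≢1+j*2 k j eq with trans (sym (Even-k*2 k)) (trans (cong (_% 2) eq) (Odd-1+k*2 j))
... | ()

Even⇒k*2 : ∀ {n} → Even n → ∃ λ k → n ≡ k * 2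
Even⇒k*2 {n} e with parity n
... | even k = k , refl
... | odd k with trans (sym e) (Odd-1+k*2 k)
...   | ()

Odd⇒>0 : ∀ {n} → Odd n → 0 < n
Odd⇒>0 {suc n} _ = z<s

Odd-<-1+k*2 : ∀ {n} k → Odd n → n < suc (k * 2) → n < k * 2
Odd-<-1+k*2 {n} k o n<1+2k with m≤n⇒m<n∨m≡n (s≤s⁻¹ n<1+2k)
... | inj₁ n<2k = n<2k
... | inj₂ refl with trans (sym o) (Even-k*2 k)
...   | ()

Even⇒[k+c]*2 : ∀ {p} c → Even p → c * 2 ≤ p → ∃ λ k → p ≡ (k + c) * 2
Even⇒[k+c]*2 {p} c e c*2≤p with Even⇒k*2 {p} e
... | m , refl = m ∸ c , cong (_* 2) (sym (m∸n+n≡m (*-cancelʳ-≤ c m 2 c*2≤p)))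

s≤s⇔ : ∀ {m n} → suc m ≤ suc n ⇔ m ≤ n
s≤s⇔ = mk⇔ s≤s⁻¹ s≤s

*2-<⇔ : ∀ {m n} → m * 2 < n * 2 ⇔ m < n
*2-<⇔ {m} {n} = mk⇔ (*-cancelʳ-< 2 m n) (*-monoˡ-< 2)

*2-≤⇔ : ∀ {m n} → m * 2 ≤ n * 2 ⇔ m ≤ n
*2-≤⇔ {m} {n} = mk⇔ (*-cancelʳ-≤ m n 2) (*-monoˡ-≤ 2)

*2-≤-1+⇔ : ∀ {m n} → m * 2 ≤ suc (n * 2) ⇔ m ≤ n
*2-≤-1+⇔ {m} {n} = mk⇔
  (λ le → Equivalence.to *2-≤⇔ (s≤s⁻¹ (≤∧≢⇒< le (k*2≢1+j*2 m n))))
  (λ le → m≤n⇒m≤1+n (Equivalence.from *2-≤⇔ le))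

+-*2-<⇔ : ∀ {m n} c → (m + c) * 2 < (n + c) * 2 ⇔ m < n
+-*2-<⇔ {m} {n} c = mk⇔
  (λ lt → +-cancelʳ-< c m n (Equivalence.to *2-<⇔ lt))
  (λ lt → Equivalence.from *2-<⇔ (+-monoˡ-< c lt))

-- From LG partitions to signed partitions

LGRel⇒> : ∀ {x y} → LGRel x y → y < x
LGRel⇒> {x} {y} = <-≤-trans (m<m+n y LGgap>0)
  where
  LGgap>0 : 0 < LGgap x y
  LGgap>0 with isOdd x ∧ isOdd y
  ... | true = z<s
  ... | false = z<s

LGRel⇔ : ∀ {x y g} → LGgap x y ≡ g → LGRel x y ⇔ g + y ≤ x
LGRel⇔ {x} {y} refl = mk⇔ (subst (_≤ x) (+-comm y _)) (subst (_≤ x) (+-comm _ y))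

LGgap-k*2 : ∀ i y → LGgap (i * 2) y ≡ 2
LGgap-k*2 i y rewrite isOdd-k*2 i = refl

LGgap-1+k*2-k*2 : ∀ i j → LGgap (suc (i * 2)) (j * 2) ≡ 2
LGgap-1+k*2-k*2 i j rewrite isOdd-1+k*2 i | isOdd-k*2 j = refl

LGgap-1+k*2-1+k*2 : ∀ i j → LGgap (suc (i * 2)) (suc (j * 2)) ≡ 4
LGgap-1+k*2-1+k*2 i j rewrite isOdd-1+k*2 i | isOdd-1+k*2 j = refl

raise : ℕ → ℕ → ℕ
raise c x with parity x
... | even k = (k + c) * 2
... | odd k = (suc k + c) * 2

tally : ℕ → ℕ → ℕ
tally c x with parity x
... | even _ = c
... | odd _ = suc c

positives : ℕ → List ℕ → List ℕ
positives c [] = []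
positives c (x ∷ xs) = raise c x ∷ positives (tally c x) xs

negatives : List ℕ → List ℕ
negatives [] = []
negatives (x ∷ xs) with parity x
... | even _ = negatives xs
... | odd _ = suc (length xs * 2) ∷ negatives xs

positives-k*2 : ∀ c k l → positives c (k * 2 ∷ l) ≡ (k + c) * 2 ∷ positives c l
positives-k*2 c k l rewrite parity-k*2 k = refl

positives-1+k*2 : ∀ c k l → positives c (suc (k * 2) ∷ l) ≡ (suc k + c) * 2 ∷ positives (suc c) l
positives-1+k*2 c k l rewrite parity-1+k*2 k = refl

negatives-k*2 : ∀ k l → negatives (k * 2 ∷ l) ≡ negatives l
negatives-k*2 k l rewrite parity-k*2 k = refl

negatives-1+k*2 : ∀ k l → negatives (suc (k * 2) ∷ l) ≡ suc (length l * 2) ∷ negatives l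
negatives-1+k*2 k l rewrite parity-1+k*2 k = refl

length-positives : ∀ c l → length (positives c l) ≡ length l
length-positives c [] = refl
length-positives c (x ∷ xs) = cong suc (length-positives (tally c x) xs)

positives-even : ∀ c l → All Even (positives c l)
positives-even c [] = []
positives-even c (x ∷ xs) = raise-even ∷ positives-even (tally c x) xs
  where
  raise-even : Even (raise c x)
  raise-even with parity x
  ... | even k = Even-k*2 (k + c)
  ... | odd k = Even-k*2 (suc k + c)

≤-raise : ∀ c x → x ≤ raise c x
≤-raise c x with parity x
... | even k = *-monoˡ-≤ 2 (m≤m+n k c)
... | odd k = ≤-trans (n≤1+n _) (*-monoˡ-≤ 2 (m≤m+n (suc k) c))

positives-positive : ∀ c {l} → All (0 <_) l → All (0 <_) (positives c l)
positives-positive c [] = []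
positives-positive c {x ∷ _} (x>0 ∷ xs>0) =
  <-≤-trans x>0 (≤-raise c x) ∷ positives-positive (tally c x) xs>0

negatives-odd : ∀ l → All Odd (negatives l)
negatives-odd [] = []
negatives-odd (x ∷ xs) with parity x
... | even _ = negatives-odd xs
... | odd _ = Odd-1+k*2 (length xs) ∷ negatives-odd xs

negatives-bounded : ∀ l → All (_< length l * 2) (negatives l)
negatives-bounded [] = []
negatives-bounded (x ∷ xs) with parity x
... | even _ = All.map (λ v< → <-≤-trans v< (m≤n+m _ 2)) (negatives-bounded xs)
... | odd _ = n<1+n _ ∷ All.map (λ v< → <-≤-trans v< (m≤n+m _ 2)) (negatives-bounded xs)

negatives-decreasing : ∀ l → Linked _>_ (negatives l)
negatives-decreasing [] = []
negatives-decreasing (x ∷ xs) with parity x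
... | even _ = negatives-decreasing xs
... | odd _ = All⇒Linked-∷ (All.map m<n⇒m<1+n (negatives-bounded xs)) (negatives-decreasing xs)

sum-positives : ∀ c l → sum (positives c l) ≡ c * 2 * length l + (sum l + sum (negatives l))
sum-positives c [] = sym (trans (+-identityʳ (c * 2 * 0)) (*-zeroʳ (c * 2)))
sum-positives c (x ∷ xs) with parity x
... | even k rewrite sum-positives c xs = even-step k c (sum xs) (sum (negatives xs)) (length xs)
  where
  even-step : ∀ k c s v n → (k + c) * 2 + (c * 2 * n + (s + v)) ≡ c * 2 * suc n + (k * 2 + s + v)
  even-step = solve-∀
... | odd k rewrite sum-positives (suc c) xs = odd-step k c (sum xs) (sum (negatives xs)) (length xs)
  where
  odd-step : ∀ k c s v n →
             (suc k + c) * 2 + (suc c * 2 * n + (s + v)) ≡ c * 2 * suc n + (suc (k * 2) + s + suc (n * 2 + v))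
  odd-step = solve-∀

LGRel⇔raise-< : ∀ c x y → LGRel x y ⇔ raise (tally c x) y < raise c x
LGRel⇔raise-< c x y with parity x | parity y
... | even i | even j = begin
  LGRel (i * 2) (j * 2)      ≈⟨ LGRel⇔ (LGgap-k*2 i (j * 2)) ⟩
  suc j * 2 ≤ i * 2          ≈⟨ *2-≤⇔ ⟩
  j < i                      ≈⟨ +-*2-<⇔ c ⟨
  (j + c) * 2 < (i + c) * 2  ∎
  where open ⇔-Reasoning
... | even i | odd j = begin
  LGRel (i * 2) (suc (j * 2))    ≈⟨ LGRel⇔ (LGgap-k*2 i (suc (j * 2))) ⟩
  suc j * 2 < i * 2              ≈⟨ *2-<⇔ ⟩
  suc j < i                      ≈⟨ +-*2-<⇔ c ⟨
  (suc j + c) * 2 < (i + c) * 2  ∎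
  where open ⇔-Reasoning
... | odd i | even j = begin
  LGRel (suc (i * 2)) (j * 2)        ≈⟨ LGRel⇔ (LGgap-1+k*2-k*2 i j) ⟩
  suc j * 2 ≤ suc (i * 2)            ≈⟨ *2-≤-1+⇔ ⟩
  suc j ≤ i                          ≈⟨ s≤s⇔ ⟨
  suc j < suc i                      ≈⟨ +-*2-<⇔ c ⟨
  (suc j + c) * 2 < (suc i + c) * 2  ≡⟨ cong (λ a → a * 2 < (suc i + c) * 2) (+-suc j c) ⟨
  (j + suc c) * 2 < (suc i + c) * 2  ∎
  where open ⇔-Reasoning
... | odd i | odd j = begin
  LGRel (suc (i * 2)) (suc (j * 2))          ≈⟨ LGRel⇔ (LGgap-1+k*2-1+k*2 i j) ⟩
  suc (suc j) * 2 < suc (i * 2)              ≈⟨ s≤s⇔ ⟩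
  suc (suc j) * 2 ≤ i * 2                    ≈⟨ *2-≤⇔ ⟩
  suc (suc j) ≤ i                            ≈⟨ s≤s⇔ ⟨
  suc (suc j) < suc i                        ≈⟨ +-*2-<⇔ c ⟨
  (suc (suc j) + c) * 2 < (suc i + c) * 2    ≡⟨ cong (λ a → a * 2 < (suc i + c) * 2) (+-suc (suc j) c) ⟨
  (suc j + suc c) * 2 < (suc i + c) * 2      ∎
  where open ⇔-Reasoning

LG⇒positives-decreasing : ∀ c {l} → Linked LGRel l → Linked _>_ (positives c l)
LG⇒positives-decreasing c [] = []
LG⇒positives-decreasing c [-] = [-]
LG⇒positives-decreasing c {x ∷ y ∷ _} (r ∷ rs) =
  Equivalence.to (LGRel⇔raise-< c x y) r ∷ LG⇒positives-decreasing (tally c x) rs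

positives-decreasing⇒LG : ∀ c l → Linked _>_ (positives c l) → Linked LGRel l
positives-decreasing⇒LG c [] _ = []
positives-decreasing⇒LG c (x ∷ []) _ = [-]
positives-decreasing⇒LG c (x ∷ y ∷ ys) (g ∷ gs) =
  Equivalence.from (LGRel⇔raise-< c x y) g ∷ positives-decreasing⇒LG (tally c x) (y ∷ ys) gs

δ₁≤1 : ∀ ν → δ₁ ν ≤ 1
δ₁≤1 ν with last ν
... | nothing = z≤n
... | just 0 = z≤n
... | just 1 = ≤-refl
... | just (suc (suc _)) = z≤n

δ₁-∷ : ∀ {v} ν → 1 < v → δ₁ (v ∷ ν) ≡ δ₁ ν
δ₁-∷ [] (s≤s (s≤s _)) = refl
δ₁-∷ (_ ∷ _) _ = refl

-- SmallestCond π ν is LastBound 0 π ν with the truncated subtraction moved to the other side.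
LastBound : ℕ → List ℕ → List ℕ → Set
LastBound c π ν = Maybe.All (λ s → (c + length ν) * 2 < δ₁ ν + s) (last π)

SmallestCond⇔LastBound : ∀ π ν → Maybe.All (0 <_) (last π) → SmallestCond π ν ⇔ LastBound 0 π ν
SmallestCond⇔LastBound π ν last>0 with last π | last>0
... | nothing | nothing = mk⇔ (λ _ → nothing) (λ _ → tt)
... | just s | just s>0 = mk⇔
  (λ lt → just (subst (_< δ₁ ν + s) (*-comm 2 (length ν))
                 (≤-<-trans (m≤n+m∸n (2 * length ν) (δ₁ ν)) (+-monoʳ-< (δ₁ ν) lt))))
  (λ { (just lt) →
    m<n+o⇒m∸n<o (2 * length ν) (δ₁ ν) {{>-nonZero s>0}} (subst (_< δ₁ ν + s) (*-comm (length ν) 2) lt) })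

tally-+-length : ∀ c x l → c + length (negatives (x ∷ l)) ≡ tally c x + length (negatives l)
tally-+-length c x l with parity x
... | even _ = refl
... | odd _ = +-suc c _

δ₁-negatives : ∀ x y ys → δ₁ (negatives (x ∷ y ∷ ys)) ≡ δ₁ (negatives (y ∷ ys))
δ₁-negatives x y ys with parity x
... | even _ = refl
... | odd _ = δ₁-∷ (negatives (y ∷ ys)) (s≤s (s≤s z≤n))

lastBound⇔lastPositive : ∀ c l → LastBound c (positives c l) (negatives l) ⇔ Maybe.All (0 <_) (last l)
lastBound⇔lastPositive c [] = mk⇔ (λ _ → nothing) (λ _ → nothing)
lastBound⇔lastPositive c (x ∷ []) with parity x
... | even k = begin
  Maybe.All _ (just ((k + c) * 2))  ≈⟨ Maybe.just-equivalence ⟨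
  (c + 0) * 2 < (k + c) * 2          ≡⟨ cong (λ a → a * 2 < (k + c) * 2) (+-identityʳ c) ⟩
  (0 + c) * 2 < (k + c) * 2          ≈⟨ +-*2-<⇔ c ⟩
  0 < k                              ≈⟨ *2-<⇔ ⟨
  0 < k * 2                          ≈⟨ Maybe.just-equivalence ⟩
  Maybe.All (0 <_) (just (k * 2))    ∎
  where open ⇔-Reasoning
... | odd k = mk⇔ (λ _ → just z<s) (λ _ → just (s≤s (*-monoˡ-≤ 2 c+1≤1+k+c)))
  where
  c+1≤1+k+c : c + 1 ≤ suc k + c
  c+1≤1+k+c = subst (_≤ suc k + c) (+-comm 1 c) (s≤s (m≤n+m c k))
lastBound⇔lastPositive c (x ∷ ys@(y ∷ _)) =
  subst₂ (λ t d → Maybe.All (λ s → t * 2 < d + s) (last (positives (tally c x) ys))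
                  ⇔ Maybe.All (0 <_) (last ys))
    (sym (tally-+-length c x ys)) (sym (δ₁-negatives x y _)) (lastBound⇔lastPositive (tally c x) ys)

-- From signed partitions back to LG partitions

dropIfHead : ℕ → List ℕ → Maybe (List ℕ)
dropIfHead v [] = nothing
dropIfHead v (w ∷ ν) with v ≟ w
... | yes _ = just ν
... | no _ = nothing

dropIfHead-≡ : ∀ {v w} ν → v ≡ w → dropIfHead v (w ∷ ν) ≡ just ν
dropIfHead-≡ {v} ν refl rewrite ≟-diag (refl {x = v}) = refl

dropIfHead-< : ∀ {v ν} → All (_< v) ν → dropIfHead v ν ≡ nothing
dropIfHead-< [] = refl
dropIfHead-< {v} {w ∷ _} (w<v ∷ _) with v ≟ w
... | yes refl = ⊥-elim (<-irrefl refl w<v)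
... | no _ = refl

dropIfHead-just : ∀ {v ν ν′} → dropIfHead v ν ≡ just ν′ → ν ≡ v ∷ ν′
dropIfHead-just {v} {w ∷ _} eq with v ≟ w
dropIfHead-just {v} {w ∷ _} refl | yes refl = refl

dropIfHead-nothing : ∀ {v ν} → dropIfHead v ν ≡ nothing → Linked _>_ ν → All (_≤ v) ν → All (_< v) ν
dropIfHead-nothing {ν = []} _ _ _ = []
dropIfHead-nothing {v} {w ∷ _} eq ds (w≤v ∷ _) with v ≟ w
... | no v≢w = Linked⇒All (flip <-trans) (≤∧≢⇒< w≤v (v≢w ∘ sym)) ds

recover : ℕ → List ℕ → List ℕ → List ℕ
recover c [] ν = []
recover c (p ∷ π) ν with dropIfHead (suc (length π * 2)) ν
... | just ν′ = p ∸ suc (c * 2) ∷ recover (suc c) π ν′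
... | nothing = p ∸ c * 2 ∷ recover c π ν

recover-just : ∀ {c p π ν ν′} → dropIfHead (suc (length π * 2)) ν ≡ just ν′ →
               recover c (p ∷ π) ν ≡ p ∸ suc (c * 2) ∷ recover (suc c) π ν′
recover-just eq rewrite eq = refl

recover-nothing : ∀ {c p π ν} → dropIfHead (suc (length π * 2)) ν ≡ nothing →
                  recover c (p ∷ π) ν ≡ p ∸ c * 2 ∷ recover c π ν
recover-nothing eq rewrite eq = refl

length-recover : ∀ c π ν → length (recover c π ν) ≡ length π
length-recover c [] ν = refl
length-recover c (p ∷ π) ν with dropIfHead (suc (length π * 2)) ν
... | just ν′ = cong suc (length-recover (suc c) π ν′)
... | nothing = cong suc (length-recover c π ν)

[k+c]*2∸c*2≡k*2 : ∀ k c → (k + c) * 2 ∸ c * 2 ≡ k * 2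
[k+c]*2∸c*2≡k*2 k c = trans (cong (_∸ c * 2) (*-distribʳ-+ 2 k c)) (m+n∸n≡m (k * 2) (c * 2))

[1+k+c]*2∸1+c*2≡1+k*2 : ∀ k c → (suc k + c) * 2 ∸ suc (c * 2) ≡ suc (k * 2)
[1+k+c]*2∸1+c*2≡1+k*2 k c =
  trans (cong (λ n → suc n ∸ c * 2) (*-distribʳ-+ 2 k c)) (m+n∸n≡m (suc (k * 2)) (c * 2))

recover-positives : ∀ c l → recover c (positives c l) (negatives l) ≡ l
recover-positives c [] = refl
recover-positives c (x ∷ xs) with parity x
... | even k = trans (recover-nothing (dropIfHead-< negatives<1+len*2))
  (cong₂ _∷_ ([k+c]*2∸c*2≡k*2 k c) (recover-positives c xs))
  where
  negatives<1+len*2 : All (_< suc (length (positives c xs) * 2)) (negatives xs)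
  negatives<1+len*2 = subst (λ n → All (_< suc (n * 2)) (negatives xs)) (sym (length-positives c xs))
    (All.map m<n⇒m<1+n (negatives-bounded xs))
... | odd k =
  trans (recover-just (dropIfHead-≡ (negatives xs) (cong (λ n → suc (n * 2)) (length-positives (suc c) xs))))
  (cong₂ _∷_ ([1+k+c]*2∸1+c*2≡1+k*2 k c) (recover-positives (suc c) xs))

-- `above` is what keeps the subtractions in `recover` exact.
record Recoverable (c : ℕ) (π ν : List ℕ) : Set where
  field
    even-parts : All Even π
    above      : All (λ p → (c + length ν) * 2 < δ₁ ν + p) π
    odd-parts  : All Odd ν
    decreasing : Linked _>_ ν
    bounded    : All (_< length π * 2) ν

<δ₁+⇒≤ : ∀ ν {m p} → m < δ₁ ν + p → m ≤ p
<δ₁+⇒≤ ν {p = p} lt = s≤s⁻¹ (<-≤-trans lt (+-monoˡ-≤ p (δ₁≤1 ν)))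

above-suc : ∀ {c ν} qs → let v = suc (length qs * 2) in
            All (λ q → (c + length (v ∷ ν)) * 2 < δ₁ (v ∷ ν) + q) qs →
            All (λ q → (suc c + length ν) * 2 < δ₁ ν + q) qs
above-suc [] _ = []
above-suc {c} {ν} (_ ∷ _) above =
  All.map (λ {q} → subst₂ (λ t d → t * 2 < d + q) (+-suc c (length ν)) (δ₁-∷ ν (s≤s (s≤s z≤n)))) above

module _ {c p π ν} (r : Recoverable c (p ∷ π) ν) where
  open Recoverable r

  recoverable-odd-step : ∀ {ν′} → dropIfHead (suc (length π * 2)) ν ≡ just ν′ →
                         Recoverable (suc c) π ν′ × ∃ λ k → p ≡ (suc k + c) * 2
  recoverable-odd-step {ν′} eq with dropIfHead-just {suc (length π * 2)} {ν} eq
  ... | refl = record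
    { even-parts = All.tail even-parts
    ; above      = above-suc {c} {ν′} π (All.tail above)
    ; odd-parts  = All.tail odd-parts
    ; decreasing = Linked.tail decreasing
    ; bounded    = All.zipWith (λ (o , w<v) → Odd-<-1+k*2 (length π) o w<v)
                     (All.tail odd-parts , Linked>⇒All< decreasing)
    } , let k , p≡ = Even⇒[k+c]*2 (suc c) (All.head even-parts) 1+c*2≤p
        in k , trans p≡ (cong (_* 2) (+-suc k c))
    where
    1+c*2≤p : suc c * 2 ≤ p
    1+c*2≤p = ≤-trans (*-monoˡ-≤ 2 (subst (suc c ≤_) (sym (+-suc c _)) (s≤s (m≤m+n c _))))
                      (<δ₁+⇒≤ ν (All.head above))

  recoverable-even-step : dropIfHead (suc (length π * 2)) ν ≡ nothing →
                          Recoverable c π ν × ∃ λ k → p ≡ (k + c) * 2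
  recoverable-even-step eq = record
    { even-parts = All.tail even-parts
    ; above      = All.tail above
    ; odd-parts  = odd-parts
    ; decreasing = decreasing
    ; bounded    = All.zipWith (λ (o , w<v) → Odd-<-1+k*2 (length π) o w<v)
                     (odd-parts , dropIfHead-nothing eq decreasing (All.map s≤s⁻¹ bounded))
    } , Even⇒[k+c]*2 c (All.head even-parts) c*2≤p
    where
    c*2≤p : c * 2 ≤ p
    c*2≤p = ≤-trans (*-monoˡ-≤ 2 (m≤m+n c (length ν))) (<δ₁+⇒≤ ν (All.head above))

positives-negatives-recover : ∀ c π ν → Recoverable c π ν →
                              positives c (recover c π ν) ≡ π × negatives (recover c π ν) ≡ ν
positives-negatives-recover c [] [] _ = refl , refl
positives-negatives-recover c [] (_ ∷ _) r with Recoverable.bounded r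
... | () ∷ _
positives-negatives-recover c (p ∷ π) ν r with dropIfHead (suc (length π * 2)) ν in eq
... | just ν′ with recoverable-odd-step r eq | dropIfHead-just {ν = ν} eq
...   | r′ , k , refl | refl rewrite [1+k+c]*2∸1+c*2≡1+k*2 k c =
  trans (positives-1+k*2 c k l′) (cong (_ ∷_) (proj₁ IH)) ,
  trans (negatives-1+k*2 k l′) (cong₂ _∷_ (cong (λ n → suc (n * 2)) (length-recover (suc c) π ν′)) (proj₂ IH))
  where
  l′ = recover (suc c) π ν′
  IH = positives-negatives-recover (suc c) π ν′ r′
positives-negatives-recover c (p ∷ π) ν r | nothing with recoverable-even-step r eq
...   | r′ , k , refl rewrite [k+c]*2∸c*2≡k*2 k c =
  trans (positives-k*2 c k l′) (cong (_ ∷_) (proj₁ IH)) ,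
  trans (negatives-k*2 k l′) (proj₂ IH)
  where
  l′ = recover c π ν
  IH = positives-negatives-recover c π ν r′

IsPartition-irrelevant : ∀ l → Irrelevant (IsPartition l)
IsPartition-irrelevant l = All.irrelevant <-irrelevant ×-irrelevant Linked.irrelevant ≤-irrelevant

SmallestCond-irrelevant : ∀ π ν → Irrelevant (SmallestCond π ν)
SmallestCond-irrelevant π ν with last π
... | nothing = λ _ _ → refl
... | just _ = <-irrelevant

LG₁Set-≡ : ∀ {n} {x y : LG₁Set n} → proj₁ x ≡ proj₁ y → x ≡ y
LG₁Set-≡ {x = l , p} {y = .l , q} refl = cong (l ,_)
  ((IsPartition-irrelevant l ×-irrelevant ≡-irrelevant ×-irrelevant Linked.irrelevant ≤-irrelevant) p q)

ESet-≡ : ∀ {n} {x y : ESet n} → proj₁ x ≡ proj₁ y → proj₁ (proj₂ x) ≡ proj₁ (proj₂ y) → x ≡ y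
ESet-≡ {x = π , ν , p} {y = .π , .ν , q} refl refl = cong (λ e → π , ν , e)
  ((IsPartition-irrelevant π ×-irrelevant IsPartition-irrelevant ν ×-irrelevant ≡-irrelevant ×-irrelevant
    All.irrelevant ≡-irrelevant ×-irrelevant Linked.irrelevant <-irrelevant ×-irrelevant
    All.irrelevant ≡-irrelevant ×-irrelevant Linked.irrelevant <-irrelevant ×-irrelevant
    All.irrelevant <-irrelevant ×-irrelevant SmallestCond-irrelevant π ν) p q)

LG₁Set→ESet : ∀ {n} → LG₁Set n → ESet n
LG₁Set→ESet (l , (l>0 , _) , sum≡n , lg) =
  π , ν ,
  (positives-positive 0 l>0 , Linked.map <⇒≤ π-distinct) ,
  (All.map Odd⇒>0 (negatives-odd l) , Linked.map <⇒≤ (negatives-decreasing l)) ,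
  trans (sum-positives 0 l) (cong (_+ sum ν) sum≡n) ,
  positives-even 0 l , π-distinct ,
  negatives-odd l , negatives-decreasing l ,
  subst (λ m → All (_< m) ν) (trans (*-comm (length l) 2) (cong (2 *_) (sym (length-positives 0 l))))
    (negatives-bounded l) ,
  Equivalence.from (SmallestCond⇔LastBound π ν (All.last⁺ (positives-positive 0 l>0)))
    (Equivalence.from (lastBound⇔lastPositive 0 l) (All.last⁺ l>0))
  where
  π = positives 0 l
  ν = negatives l
  π-distinct = LG⇒positives-decreasing 0 lg

ESet⇒LastBound : ∀ {n} (e : ESet n) → LastBound 0 (proj₁ e) (proj₁ (proj₂ e))
ESet⇒LastBound (π , ν , (π>0 , _) , _ , _ , _ , _ , _ , _ , _ , smallest) =
  Equivalence.to (SmallestCond⇔LastBound π ν (All.last⁺ π>0)) smallest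

ESet⇒Recoverable : ∀ {n} (e : ESet n) → Recoverable 0 (proj₁ e) (proj₁ (proj₂ e))
ESet⇒Recoverable e@(π , ν , _ , _ , _ , π-even , π-distinct , ν-odd , ν-distinct , ν-bounded , _) = record
  { even-parts = π-even
  ; above      = last⇒All (λ b<a lt → <-trans lt (+-monoʳ-< (δ₁ ν) b<a)) π-distinct (ESet⇒LastBound e)
  ; odd-parts  = ν-odd
  ; decreasing = ν-distinct
  ; bounded    = subst (λ m → All (_< m) ν) (*-comm 2 (length π)) ν-bounded
  }

ESet→LG₁Set : ∀ {n} → ESet n → LG₁Set n
ESet→LG₁Set {n} e@(π , ν , _ , _ , sumπ≡ , _ , π-distinct , _) =
  l , (l>0 , Linked.map (<⇒≤ ∘ LGRel⇒>) lg) , sum-l , lg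
  where
  l = recover 0 π ν
  π≡ = proj₁ (positives-negatives-recover 0 π ν (ESet⇒Recoverable e))
  ν≡ = proj₂ (positives-negatives-recover 0 π ν (ESet⇒Recoverable e))
  lg : Linked LGRel l
  lg = positives-decreasing⇒LG 0 l (subst (Linked _>_) (sym π≡) π-distinct)
  l>0 : All (0 <_) l
  l>0 = last⇒All (λ r y>0 → <-trans y>0 (LGRel⇒> r)) lg
          (Equivalence.to (lastBound⇔lastPositive 0 l)
            (subst₂ (LastBound 0) (sym π≡) (sym ν≡) (ESet⇒LastBound e)))
  sum-l : sum l ≡ n
  sum-l = +-cancelʳ-≡ (sum ν) (sum l) n (begin
    sum l + sum ν              ≡⟨ cong (λ ν′ → sum l + sum ν′) ν≡ ⟨
    sum l + sum (negatives l)  ≡⟨ sum-positives 0 l ⟨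
    sum (positives 0 l)        ≡⟨ cong sum π≡ ⟩
    sum π                      ≡⟨ sumπ≡ ⟩
    n + sum ν                  ∎)
    where open ≡-Reasoning

LG₁Set↔ESet : ∀ n → LG₁Set n ↔ ESet n
LG₁Set↔ESet n = mk↔ₛ′ LG₁Set→ESet ESet→LG₁Set
  (λ e@(π , ν , _) → let (π≡ , ν≡) = positives-negatives-recover 0 π ν (ESet⇒Recoverable e) in ESet-≡ π≡ ν≡)
  (λ (l , _) → LG₁Set-≡ (recover-positives 0 l))

-- Finiteness

decreasingLists : ℕ → List (List ℕ)
decreasingLists zero = [] ∷ []
decreasingLists (suc N) = decreasingLists N ++ map (suc N ∷_) (decreasingLists N)

∈-decreasingLists : ∀ N {l} → Linked _>_ l → All (0 <_) l → All (_≤ N) l → l ∈ decreasingLists N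
∈-decreasingLists zero {[]} _ _ _ = here refl
∈-decreasingLists zero {x ∷ _} _ (x>0 ∷ _) (x≤0 ∷ _) = ⊥-elim (<-irrefl refl (<-≤-trans x>0 x≤0))
∈-decreasingLists (suc N) {[]} _ _ _ = ∈-++⁺ˡ (∈-decreasingLists N [] [] [])
∈-decreasingLists (suc N) {x ∷ xs} ds (x>0 ∷ xs>0) (x≤1+N ∷ _) with x ≟ suc N
... | yes refl = ∈-++⁺ʳ (decreasingLists N)
  (∈-map⁺ (suc N ∷_) (∈-decreasingLists N (Linked.tail ds) xs>0 (All.map s≤s⁻¹ (Linked>⇒All< ds))))
... | no x≢1+N = ∈-++⁺ˡ (∈-decreasingLists N ds (x>0 ∷ xs>0)
    (x≤N ∷ All.map (λ y<x → ≤-trans (<⇒≤ y<x) x≤N) (Linked>⇒All< ds)))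
  where
  x≤N : x ≤ N
  x≤N = s≤s⁻¹ (≤∧≢⇒< x≤1+N x≢1+N)

parts≤sum : ∀ l → All (_≤ sum l) l
parts≤sum [] = []
parts≤sum (x ∷ xs) = m≤m+n x (sum xs) ∷ All.map (λ y≤ → ≤-trans y≤ (m≤n+m (sum xs) x)) (parts≤sum xs)

LG₁Set-finite : ∀ n → ∃ λ m → LG₁Set n ↔ Fin m
LG₁Set-finite n = covered⇒Σ↔Fin (List.≡-dec _≟_) LG? LG-irrelevant (decreasingLists n) LG⊆
  where
  LG? : ∀ l → Dec (IsPartition l × sum l ≡ n × Linked LGRel l)
  LG? l = (All.all? (0 <?_) l ×-dec Linked.linked? (λ a b → b ≤? a) l) ×-dec (sum l ≟ n)
          ×-dec Linked.linked? (λ a b → b + LGgap a b ≤? a) l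
  LG-irrelevant : U.Irrelevant (λ l → IsPartition l × sum l ≡ n × Linked LGRel l)
  LG-irrelevant = IsPartition-irrelevant _ ×-irrelevant ≡-irrelevant ×-irrelevant Linked.irrelevant ≤-irrelevant
  LG⊆ : ∀ {l} → IsPartition l × sum l ≡ n × Linked LGRel l → l ∈ decreasingLists n
  LG⊆ {l} ((l>0 , _) , refl , lg) = ∈-decreasingLists (sum l) (Linked.map LGRel⇒> lg) l>0 (parts≤sum l)

theorem5p1 : (n : ℕ) → Σ ℕ (λ m → (LG₁Set n ↔ Fin m) × (ESet n ↔ Fin m))
theorem5p1 n with LG₁Set-finite n
... | m , LG₁↔Fin = m , LG₁↔Fin , ↔-trans (↔-sym (LG₁Set↔ESet n)) LG₁↔Fin
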